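{- Let $t$ and $u$ be terms and $\pi$ a stack. If $t\equiv u$ and $t\ast\pi\Downarrow_{\rightsquigarrow}$ then $u\ast\pi\Downarrow_{\rightsquigarrow}$.
   Context: Fix pairwise disjoint countably infinite sets of $\lambda$-variables ($x,y,\dots$), stack variables ($\alpha,\beta,\dots$), term variables ($a,b,\dots$), and countable sets of labels $l$ and constructors $C$. Values, terms, stacks, processes: $v,w::=x\mid\lambda x\,t\mid C[v]\mid\{l_i=v_i\}_{i\in I}$; $t,u::=a\mid v\mid t\,u\mid\mu\alpha\,t\mid p\mid v.l\mid\mathrm{case}_v[C_i[x_i]\to t_i]_{i\in I}\mid\delta_{v,w}$; $\pi::=\alpha\mid v.\pi\mid[t]\pi$; $p::=t\ast\pi$; $I$ finite; $\lambda x$, $\mu\alpha$ and the $x_i$ in case branches are binders, term variables are never bound. Substitutions map $\lambda$-variables to values, stack variables to stacks, term variables to terms (capture-avoiding). $\succ$ is the smallest relation on processes with: $t\,u\ast\pi\succ u\ast[t]\pi$; $v\ast[t]\pi\succ t\ast v.\pi$; $\lambda x\,t\ast v.\pi\succ t[x:=v]\ast\pi$; $\mu\alpha\,t\ast\pi\succ t[\alpha:=\pi]\ast\pi$; $p\ast\pi\succ p$; $\{l_i=v_i\}_{i\in I}.l_k\ast\pi\succ v_k\ast\pi$ ($k\in I$); $\mathrm{case}_{C_k[v]}[C_i[x_i]\to t_i]_{i\in I}\ast\pi\succ t_k[x_k:=v]\ast\pi$ ($k\in I$). A process is final if it is $v\ast\alpha$ with $v$ a value and $\alpha$ a stack variable;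 for a relation $R$, $p\Downarrow_R$ means $p\,R^*\,q$ with $q$ final. For $i\in\mathbb N$, inductively: $\rightsquigarrow_i=\succ\cup\{(\delta_{v,w}\ast\pi,v\ast\pi)\mid\exists j<i,\ v\not\equiv_jw\}$; $t\equiv_iu$ iff for all $j\le i$, stacks $\pi$, substitutions $\sigma$: $t\sigma\ast\pi\Downarrow_{\rightsquigarrow_j}\Leftrightarrow u\sigma\ast\pi\Downarrow_{\rightsquigarrow_j}$; $\not\equiv_i$ is its negation. $\rightsquigarrow=\bigcup_i\rightsquigarrow_i$, $\equiv=\bigcap_i\equiv_i$. -}

module Defs where

open import Data.Nat using (ℕ; zero; suc)
open import Data.Product using (Σ; ∃; _×_; _,_)
open import Data.Sum using (_⊎_)
open import Data.Empty using (⊥)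
open import Function using (id; _∘_)
open import Relation.Nullary using (¬_)
open import Relation.Binary.PropositionalEquality using (_≡_)
open import Relation.Binary.Construct.Closure.ReflexiveTransitive using (Star)

-- Syntax (de Bruijn indices for λ-variables and stack variables;
-- term variables are named by ℕ and never bound).

mutual
  data Val : Set where
    var : ℕ → Val
    lam : Term → Val
    con : ℕ → Val → Val
    rec : Fields → Val

  data Fields : Set where
    fnil  : Fields
    fcons : ℕ → Val → Fields → Fields

  data Term : Set where
    tvar  : ℕ → Term
    val   : Val → Term
    app   : Term → Term → Term
    mu    : Term → Term           -- μα t  (binds stack index 0)
    proc  : Proc → Term
    proj  : Val → ℕ → Term
    case  : Val → Branches → Term
    delta : Val → Val → Term

  data Branches : Set where
    bnil  : Branches
    bcons : ℕ → Term → Branches → Branches   -- C[x] → t (binds λ-index 0 in t)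

  data Stack : Set where
    svar  : ℕ → Stack
    push  : Val → Stack → Stack
    frame : Term → Stack → Stack

  data Proc : Set where
    _∗_ : Term → Stack → Proc

infix 4 _∗_

-- Renaming (first argument acts on λ-variables, second on stack variables)

ext : (ℕ → ℕ) → ℕ → ℕ
ext r zero    = zero
ext r (suc n) = suc (r n)

mutual
  renV : (ℕ → ℕ) → (ℕ → ℕ) → Val → Val
  renV a b (var x)   = var (a x)
  renV a b (lam t)   = lam (renT (ext a) b t)
  renV a b (con c v) = con c (renV a b v)
  renV a b (rec fs)  = rec (renF a b fs)

  renF : (ℕ → ℕ) → (ℕ → ℕ) → Fields → Fields
  renF a b fnil           = fnil
  renF a b (fcons l v fs) = fcons l (renV a b v) (renF a b fs)

  renT : (ℕ → ℕ) → (ℕ → ℕ) → Term → Term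
  renT a b (tvar n)    = tvar n
  renT a b (val v)     = val (renV a b v)
  renT a b (app t u)   = app (renT a b t) (renT a b u)
  renT a b (mu t)      = mu (renT a (ext b) t)
  renT a b (proc p)    = proc (renP a b p)
  renT a b (proj v l)  = proj (renV a b v) l
  renT a b (case v bs) = case (renV a b v) (renB a b bs)
  renT a b (delta v w) = delta (renV a b v) (renV a b w)

  renB : (ℕ → ℕ) → (ℕ → ℕ) → Branches → Branches
  renB a b bnil            = bnil
  renB a b (bcons c t bs)  = bcons c (renT (ext a) b t) (renB a b bs)

  renS : (ℕ → ℕ) → (ℕ → ℕ) → Stack → Stack
  renS a b (svar n)    = svar (b n)
  renS a b (push v π)  = push (renV a b v) (renS a b π)
  renS a b (frame t π) = frame (renT a b t) (renS a b π)

  renP : (ℕ → ℕ) → (ℕ → ℕ) → Proc → Proc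
  renP a b (t ∗ π) = renT a b t ∗ renS a b π

record Subst : Set where
  field
    lv : ℕ → Val
    sv : ℕ → Stack
    tv : ℕ → Term
open Subst public

liftλ : Subst → Subst
liftλ σ = record
  { lv = λ { zero → var zero ; (suc n) → renV suc id (lv σ n) }
  ; sv = λ n → renS suc id (sv σ n)
  ; tv = λ n → renT suc id (tv σ n) }

liftμ : Subst → Subst
liftμ σ = record
  { lv = λ n → renV id suc (lv σ n)
  ; sv = λ { zero → svar zero ; (suc n) → renS id suc (sv σ n) }
  ; tv = λ n → renT id suc (tv σ n) }

mutual
  subV : Subst → Val → Val
  subV σ (var x)   = lv σ x
  subV σ (lam t)   = lam (subT (liftλ σ) t)
  subV σ (con c v) = con c (subV σ v)
  subV σ (rec fs)  = rec (subF σ fs)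

  subF : Subst → Fields → Fields
  subF σ fnil           = fnil
  subF σ (fcons l v fs) = fcons l (subV σ v) (subF σ fs)

  subT : Subst → Term → Term
  subT σ (tvar n)    = tv σ n
  subT σ (val v)     = val (subV σ v)
  subT σ (app t u)   = app (subT σ t) (subT σ u)
  subT σ (mu t)      = mu (subT (liftμ σ) t)
  subT σ (proc p)    = proc (subP σ p)
  subT σ (proj v l)  = proj (subV σ v) l
  subT σ (case v bs) = case (subV σ v) (subB σ bs)
  subT σ (delta v w) = delta (subV σ v) (subV σ w)

  subB : Subst → Branches → Branches
  subB σ bnil           = bnil
  subB σ (bcons c t bs) = bcons c (subT (liftλ σ) t) (subB σ bs)

  subS : Subst → Stack → Stack
  subS σ (svar n)    = sv σ n
  subS σ (push v π)  = push (subV σ v) (subS σ π)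
  subS σ (frame t π) = frame (subT σ t) (subS σ π)

  subP : Subst → Proc → Proc
  subP σ (t ∗ π) = subT σ t ∗ subS σ π

idSubst : Subst
idSubst = record { lv = var ; sv = svar ; tv = tvar }

_[λ≔_] : Term → Val → Term
t [λ≔ v ] = subT (record idSubst { lv = λ { zero → v ; (suc n) → var n } }) t

_[μ≔_] : Term → Stack → Term
t [μ≔ π ] = subT (record idSubst { sv = λ { zero → π ; (suc n) → svar n } }) t

data FieldAt : Fields → ℕ → Val → Set where
  here  : ∀ {l v fs} → FieldAt (fcons l v fs) l v
  there : ∀ {l v l' v' fs} → FieldAt fs l v → FieldAt (fcons l' v' fs) l v

data BranchAt : Branches → ℕ → Term → Set where
  here  : ∀ {c t bs} → BranchAt (bcons c t bs) c t
  there : ∀ {c t c' t' bs} → BranchAt bs c t → BranchAt (bcons c' t' bs) c t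

infix 3 _≻_
data _≻_ : Proc → Proc → Set where
  ≻-app   : ∀ {t u π} → app t u ∗ π ≻ u ∗ frame t π
  ≻-frame : ∀ {v t π} → val v ∗ frame t π ≻ t ∗ push v π
  ≻-lam   : ∀ {t v π} → val (lam t) ∗ push v π ≻ (t [λ≔ v ]) ∗ π
  ≻-mu    : ∀ {t π} → mu t ∗ π ≻ (t [μ≔ π ]) ∗ π
  ≻-proc  : ∀ {p π} → proc p ∗ π ≻ p
  ≻-proj  : ∀ {fs l v π} → FieldAt fs l v → proj (rec fs) l ∗ π ≻ val v ∗ π
  ≻-case  : ∀ {c v bs t π} → BranchAt bs c t →
            case (con c v) bs ∗ π ≻ (t [λ≔ v ]) ∗ π

data Final : Proc → Set where
  final : ∀ v n → Final (val v ∗ svar n)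

Conv : (Proc → Proc → Set) → Proc → Set
Conv R p = ∃ λ q → Star R p q × Final q

mutual
  -- Below i v w  :⇔  ∃ j < i. v ≢_j w
  Below : ℕ → Val → Val → Set
  Below zero    v w = ⊥
  Below (suc i) v w = Below i v w ⊎ ¬ Equiv i (val v) (val w)

  DeltaStep : ℕ → Proc → Proc → Set
  DeltaStep i p q = Σ Val λ v → Σ Val λ w → Σ Stack λ π →
    (p ≡ (delta v w ∗ π)) × (q ≡ (val v ∗ π)) × Below i v w

  Step : ℕ → Proc → Proc → Set
  Step i p q = (p ≻ q) ⊎ DeltaStep i p q

  EqAt : ℕ → Term → Term → Set
  EqAt j t u = ∀ (π : Stack) (σ : Subst) →
    (Conv (Step j) (subT σ t ∗ π) → Conv (Step j) (subT σ u ∗ π)) ×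
    (Conv (Step j) (subT σ u ∗ π) → Conv (Step j) (subT σ t ∗ π))

  -- t ≡_i u  :⇔  ∀ j ≤ i. EqAt j t u
  Equiv : ℕ → Term → Term → Set
  Equiv zero    t u = EqAt zero t u
  Equiv (suc i) t u = Equiv i t u × EqAt (suc i) t u

_⇝_ : Proc → Proc → Set
p ⇝ q = ∃ λ i → Step i p q

_≡obs_ : Term → Term → Set
t ≡obs u = ∀ i → Equiv i t u

-- A ⇝-reduction is a finite sequence of steps, each taken in some ⇝ᵢ; since the
-- levels are cumulative, the whole reduction lives in ⇝ₖ for k the largest level
-- used. Instantiating t ≡ₖ u at the identity substitution then moves convergence
-- under ⇝ₖ, and hence under ⇝, from t ∗ π to u ∗ π.
module Submission where

open import Defs
open import Data.Nat using (ℕ; zero; suc; _≤_; _⊔_; _≤′_; ≤′-refl; ≤′-step)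
open import Data.Nat.Properties using (m≤m⊔n; m≤n⊔m; ≤⇒≤′)
open import Data.Product using (∃; _,_; proj₁; proj₂)
open import Data.Sum using (inj₁; inj₂)
open import Function using (id; _∘_)
open import Relation.Binary.Core using (_⇒_)
open import Relation.Binary.PropositionalEquality using (_≡_; refl; cong; cong₂; subst; sym)
open import Relation.Binary.Construct.Closure.ReflexiveTransitive using (Star; ε; _◅_; map)

-- liftλ idSubst is not definitionally idSubst, so the identity law is proved for
-- every pointwise-identity substitution.
record IsIdentity (σ : Subst) : Set where
  field
    lv-id : ∀ n → lv σ n ≡ var n
    sv-id : ∀ n → sv σ n ≡ svar n
    tv-id : ∀ n → tv σ n ≡ tvar n
open IsIdentity

idSubst-isIdentity : IsIdentity idSubst
idSubst-isIdentity = record { lv-id = λ _ → refl ; sv-id = λ _ → refl ; tv-id = λ _ → refl }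

liftλ-isIdentity : ∀ {σ} → IsIdentity σ → IsIdentity (liftλ σ)
lv-id (liftλ-isIdentity h) zero    = refl
lv-id (liftλ-isIdentity h) (suc n) = cong (renV suc id) (lv-id h n)
sv-id (liftλ-isIdentity h) n       = cong (renS suc id) (sv-id h n)
tv-id (liftλ-isIdentity h) n       = cong (renT suc id) (tv-id h n)

liftμ-isIdentity : ∀ {σ} → IsIdentity σ → IsIdentity (liftμ σ)
lv-id (liftμ-isIdentity h) n       = cong (renV id suc) (lv-id h n)
sv-id (liftμ-isIdentity h) zero    = refl
sv-id (liftμ-isIdentity h) (suc n) = cong (renS id suc) (sv-id h n)
tv-id (liftμ-isIdentity h) n       = cong (renT id suc) (tv-id h n)

mutual
  subV-identity : ∀ {σ} → IsIdentity σ → ∀ v → subV σ v ≡ v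
  subV-identity h (var x)   = lv-id h x
  subV-identity h (lam t)   = cong lam (subT-identity (liftλ-isIdentity h) t)
  subV-identity h (con c v) = cong (con c) (subV-identity h v)
  subV-identity h (rec fs)  = cong rec (subF-identity h fs)

  subF-identity : ∀ {σ} → IsIdentity σ → ∀ fs → subF σ fs ≡ fs
  subF-identity h fnil           = refl
  subF-identity h (fcons l v fs) = cong₂ (fcons l) (subV-identity h v) (subF-identity h fs)

  subT-identity : ∀ {σ} → IsIdentity σ → ∀ t → subT σ t ≡ t
  subT-identity h (tvar n)    = tv-id h n
  subT-identity h (val v)     = cong val (subV-identity h v)
  subT-identity h (app t u)   = cong₂ app (subT-identity h t) (subT-identity h u)
  subT-identity h (mu t)      = cong mu (subT-identity (liftμ-isIdentity h) t)
  subT-identity h (proc p)    = cong proc (subP-identity h p)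
  subT-identity h (proj v l)  = cong (λ w → proj w l) (subV-identity h v)
  subT-identity h (case v bs) = cong₂ case (subV-identity h v) (subB-identity h bs)
  subT-identity h (delta v w) = cong₂ delta (subV-identity h v) (subV-identity h w)

  subB-identity : ∀ {σ} → IsIdentity σ → ∀ bs → subB σ bs ≡ bs
  subB-identity h bnil           = refl
  subB-identity h (bcons c t bs) =
    cong₂ (bcons c) (subT-identity (liftλ-isIdentity h) t) (subB-identity h bs)

  subS-identity : ∀ {σ} → IsIdentity σ → ∀ π → subS σ π ≡ π
  subS-identity h (svar n)    = sv-id h n
  subS-identity h (push v π)  = cong₂ push (subV-identity h v) (subS-identity h π)
  subS-identity h (frame t π) = cong₂ frame (subT-identity h t) (subS-identity h π)

  subP-identity : ∀ {σ} → IsIdentity σ → ∀ p → subP σ p ≡ p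
  subP-identity h (t ∗ π) = cong₂ _∗_ (subT-identity h t) (subS-identity h π)

Step-suc : ∀ {i} → Step i ⇒ Step (suc i)
Step-suc (inj₁ r)                           = inj₁ r
Step-suc (inj₂ (v , w , π , p≡ , q≡ , v<w)) = inj₂ (v , w , π , p≡ , q≡ , inj₁ v<w)

Step-mono′ : ∀ {i j} → i ≤′ j → Step i ⇒ Step j
Step-mono′ ≤′-refl        = id
Step-mono′ (≤′-step i≤′j) = Step-suc ∘ Step-mono′ i≤′j

Step-mono : ∀ {i j} → i ≤ j → Step i ⇒ Step j
Step-mono i≤j = Step-mono′ (≤⇒≤′ i≤j)

Star-⇝⇒Star-Step : ∀ {p q} → Star _⇝_ p q → ∃ λ k → Star (Step k) p q
Star-⇝⇒Star-Step ε = 0 , ε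
Star-⇝⇒Star-Step ((i , p⇝ᵢr) ◅ r⇝*q) with Star-⇝⇒Star-Step r⇝*q
... | k , r⇝ₖ*q = i ⊔ k , Step-mono (m≤m⊔n i k) p⇝ᵢr ◅ map (Step-mono (m≤n⊔m i k)) r⇝ₖ*q

Conv-⇝⇒Conv-Step : ∀ {p} → Conv _⇝_ p → ∃ λ k → Conv (Step k) p
Conv-⇝⇒Conv-Step (q , p⇝*q , final-q) with Star-⇝⇒Star-Step p⇝*q
... | k , p⇝ₖ*q = k , q , p⇝ₖ*q , final-q

Conv-Step⇒Conv-⇝ : ∀ {k p} → Conv (Step k) p → Conv _⇝_ p
Conv-Step⇒Conv-⇝ (q , p⇝ₖ*q , final-q) = q , map (_ ,_) p⇝ₖ*q , final-q

Equiv⇒EqAt : ∀ i {t u} → Equiv i t u → EqAt i t u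
Equiv⇒EqAt zero    t≡u = t≡u
Equiv⇒EqAt (suc i) t≡u = proj₂ t≡u

EqAt⇒Conv : ∀ {j t u} π → EqAt j t u → Conv (Step j) (t ∗ π) → Conv (Step j) (u ∗ π)
EqAt⇒Conv {j} {t} {u} π t≡u t⇓ =
  subst (λ w → Conv (Step j) (w ∗ π)) (subT-identity idSubst-isIdentity u)
    (proj₁ (t≡u π idSubst)
      (subst (λ w → Conv (Step j) (w ∗ π)) (sym (subT-identity idSubst-isIdentity t)) t⇓))

corollary1 : (t u : Term) (π : Stack) → t ≡obs u → Conv _⇝_ (t ∗ π) → Conv _⇝_ (u ∗ π)
corollary1 t u π t≡u t⇓ with Conv-⇝⇒Conv-Step t⇓
... | k , t⇓ₖ = Conv-Step⇒Conv-⇝ (EqAt⇒Conv π (Equiv⇒EqAt k (t≡u k)) t⇓ₖ)
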